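{- For every integer $n\geq 1$ there is an involution $\phi$ on the set $\overline{\mathcal{P}}(n)$ of overpartitions of $n$ which maps the subset $\overline{\mathcal{PN}}(n)$ (overpartitions of $n$ having at least one non-overlined part) to itself (so that it restricts to an involution on $\overline{\mathcal{PN}}(n)$), and such that for every $\pi\in\overline{\mathcal{P}}(n)$, with $\lambda=\phi(\pi)$, one has $\ell_{O\leq N}(\lambda)\equiv \ell_{O\geq N}(\pi)\pmod 2$.
   Context: An overpartition of $n$ is a partition of $n$ (finite non-increasing sequence of positive integers summing to $n$) in which the first occurrence of each distinct part size may be overlined. A part is of size $t$ if it equals $t$ or $\overline{t}$. For an overpartition $\pi$, let $SN(\pi)$ be the size of the smallest non-overlined part of $\pi$ if $\pi$ has non-overlined parts and $0$ otherwise, and let $\widetilde{LN}(\pi)$ be the size of the largest non-overlined part of $\pi$ if $\pi$ has non-overlined parts and $+\infty$ otherwise. $\ell_{O\geq N}(\pi)$ is the number of overlined parts of $\pi$ of size $\geq SN(\pi)$, and $\ell_{O\leq N}(\pi)$ is the number of overlined parts of $\pi$ of size $\leq \widetilde{LN}(\pi)$. -}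

module Defs where

open import Data.Nat using (ℕ; zero; suc; _≤_; _<_; _≤?_; _⊓_; _⊔_; _%_)
open import Data.Bool using (Bool; true; false)
open import Data.Product using (_×_; proj₁; proj₂; Σ; _,_)
open import Data.Maybe using (Maybe; just; nothing)
open import Data.List using (List; []; _∷_; map; length; filter; foldr)
open import Data.Nat.ListAction using (sum)
open import Data.List.Relation.Unary.All using (All)
open import Data.List.Relation.Unary.Any using (Any)
open import Data.List.Relation.Unary.Linked using (Linked)
open import Relation.Binary.PropositionalEquality using (_≡_)

Part : Set
Part = ℕ × Bool

size : Part → ℕ
size = proj₁

overlined : Part → Bool
overlined = proj₂

-- Consecutive parts x then y (list read left to right = non-increasing order):
-- size y ≤ size x, and y may be overlined only if it is the first occurrence
-- of its size, i.e. size y < size x.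
Step : Part → Part → Set
Step x y = (size y ≤ size x) × (overlined y ≡ true → size y < size x)

IsOverpartition : ℕ → List Part → Set
IsOverpartition n π =
  (sum (map size π) ≡ n) × All (λ p → 1 ≤ size p) π × Linked Step π

HasNonOverlined : List Part → Set
HasNonOverlined π = Any (λ p → overlined p ≡ false) π

nonOverlinedSizes : List Part → List ℕ
nonOverlinedSizes [] = []
nonOverlinedSizes ((s , true) ∷ π) = nonOverlinedSizes π
nonOverlinedSizes ((s , false) ∷ π) = s ∷ nonOverlinedSizes π

overlinedSizes : List Part → List ℕ
overlinedSizes [] = []
overlinedSizes ((s , true) ∷ π) = s ∷ overlinedSizes π
overlinedSizes ((s , false) ∷ π) = overlinedSizes π

SN : List Part → ℕ
SN π with nonOverlinedSizes π
... | [] = 0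
... | x ∷ xs = foldr _⊓_ x xs

-- LN~: largest non-overlined size; nothing stands for +∞.
LN~ : List Part → Maybe ℕ
LN~ π with nonOverlinedSizes π
... | [] = nothing
... | x ∷ xs = just (foldr _⊔_ x xs)

ℓO≥N : List Part → ℕ
ℓO≥N π = length (filter (λ t → SN π ≤? t) (overlinedSizes π))

ℓO≤N : List Part → ℕ
ℓO≤N π with LN~ π
... | nothing = length (overlinedSizes π)
... | just m = length (filter (λ t → t ≤? m) (overlinedSizes π))

-- If π has a repeated part size, toggle the overline of the first copy of the largest
-- repeated size a.  The second copy of a is non-overlined, so the set of non-overlined
-- sizes, and with it SN and LN~, is unchanged, while SN ≤ a ≤ LN~: both ℓO≥N and ℓO≤N
-- change by one.  So φ fixes π when ℓO≤N π ≡ ℓO≥N π (mod 2) and toggles it otherwise;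
-- toggling keeps the two parities apart, which makes φ an involution.
-- If all part sizes of π are distinct, φ reverses the sequence of overline flags read
-- from the largest part down.  For such π, ℓO≤N counts the overlined parts after the
-- first non-overlined one and ℓO≥N those before the last one (every overlined part if
-- there is none), and reversal exchanges the two.
module Submission where

open import Defs
open import Algebra.Core using (Op₂)
open import Algebra.Lattice.Structures using (IsSemilattice)
open import Data.Bool using (Bool; true; false; not; if_then_else_)
open import Data.Bool.Properties using (not-involutive)
open import Data.List using (List; []; _∷_; _∷ʳ_; map; length; filter; foldr; reverse; zip; null)
open import Data.Bool.ListAction using (any)
open import Data.List.Properties using (filter-accept; filter-reject; filter-all; filter-none; unfold-reverse; reverse-involutive; length-map; length-reverse; foldr-preservesᵇ)
open import Data.List.Relation.Unary.All as All using (All; []; _∷_)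
open import Data.List.Relation.Unary.Any using (Any; here; there)
import Data.List.Relation.Unary.Any.Properties as Any
import Data.List.Relation.Unary.All.Properties as All
open import Data.List.Relation.Unary.Linked as Linked using (Linked; []; [-]; _∷_; linked?)
open import Data.List.Relation.Unary.Linked.Properties using (Linked⇒All)
open import Data.Maybe using (Maybe; just; nothing; fromMaybe)
open import Data.Nat using (ℕ; zero; suc; _≤_; _<_; _>_; _%_; _⊓_; _⊔_; z≤n)
open import Data.Nat.ListAction using (sum)
open import Data.Nat.Properties
open import Data.Product using (Σ; _×_; _,_; proj₁; proj₂; ∃₂)
open import Data.Sum as Sum using (_⊎_; inj₁; inj₂; [_,_]′)
open import Data.Unit using (⊤; tt)
open import Function using (_∘_; flip)
open import Relation.Binary.PropositionalEquality
open import Relation.Nullary using (¬_; Dec; yes; no; contradiction)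
open import Relation.Nullary.Decidable using (dec-no)
open import Relation.Unary using (Pred; Decidable)
open import Level using (0ℓ)

%2-binary : ∀ m → m % 2 ≡ 0 ⊎ m % 2 ≡ 1
%2-binary zero = inj₁ refl
%2-binary (suc zero) = inj₂ refl
%2-binary (suc (suc m)) = %2-binary m

%2-suc-≢ : ∀ m → suc m % 2 ≢ m % 2
%2-suc-≢ zero ()
%2-suc-≢ (suc m) eq = %2-suc-≢ m (sym eq)

%2-≢⇒≡ : ∀ {m n k} → m % 2 ≢ k % 2 → n % 2 ≢ k % 2 → m % 2 ≡ n % 2
%2-≢⇒≡ {m} {n} {k} m≢k n≢k with %2-binary m | %2-binary n | %2-binary k
... | inj₁ m0 | inj₁ n0 | _      = trans m0 (sym n0)
... | inj₂ m1 | inj₂ n1 | _      = trans m1 (sym n1)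
... | inj₁ m0 | inj₂ _  | inj₁ k0 = contradiction (trans m0 (sym k0)) m≢k
... | inj₂ m1 | inj₁ _  | inj₂ k1 = contradiction (trans m1 (sym k1)) m≢k
... | inj₁ _  | inj₂ n1 | inj₂ k1 = contradiction (trans n1 (sym k1)) n≢k
... | inj₂ _  | inj₁ n0 | inj₁ k0 = contradiction (trans n0 (sym k0)) n≢k

DifferByOne : ℕ → ℕ → Set
DifferByOne m n = suc m ≡ n ⊎ m ≡ suc n

DifferByOne-suc : ∀ {m n} → DifferByOne m n → DifferByOne (suc m) (suc n)
DifferByOne-suc (inj₁ eq) = inj₁ (cong suc eq)
DifferByOne-suc (inj₂ eq) = inj₂ (cong suc eq)

DifferByOne⇒%2-≢ : ∀ {m n} → DifferByOne m n → m % 2 ≢ n % 2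
DifferByOne⇒%2-≢ {m} (inj₁ refl) = ≢-sym (%2-suc-≢ m)
DifferByOne⇒%2-≢ {n = n} (inj₂ refl) = %2-suc-≢ n

DifferByOne-flips-%2 : ∀ {m′ m} k → DifferByOne m′ m → m % 2 ≢ k % 2 → m′ % 2 ≡ k % 2
DifferByOne-flips-%2 {m′} {m} k d m≢k = %2-≢⇒≡ {m′} {k} {m} (DifferByOne⇒%2-≢ d) (≢-sym m≢k)

data Duplicated {A : Set} : List A → List A → Set where
  here  : ∀ x xs → Duplicated (x ∷ xs) (x ∷ x ∷ xs)
  there : ∀ x {xs ys} → Duplicated xs ys → Duplicated (x ∷ xs) (x ∷ ys)

fold₁ : {A : Set} → Op₂ A → List A → Maybe A
fold₁ _∙_ [] = nothing
fold₁ _∙_ (x ∷ xs) = just (foldr _∙_ x xs)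

module _ {A : Set} {_∙_ : Op₂ A} (isSemilattice : IsSemilattice _≡_ _∙_) where
  open IsSemilattice _≡_ isSemilattice using (assoc; comm; idem)

  private
    ∙-swap : ∀ x y z → x ∙ (y ∙ z) ≡ y ∙ (x ∙ z)
    ∙-swap x y z = begin
      x ∙ (y ∙ z)  ≡⟨ sym (assoc x y z) ⟩
      (x ∙ y) ∙ z  ≡⟨ cong (_∙ z) (comm x y) ⟩
      (y ∙ x) ∙ z  ≡⟨ assoc y x z ⟩
      y ∙ (x ∙ z)  ∎
      where open ≡-Reasoning

    ∙-idem-assoc : ∀ x z → x ∙ (x ∙ z) ≡ x ∙ z
    ∙-idem-assoc x z = trans (sym (assoc x x z)) (cong (_∙ z) (idem x))

    absorbs-∷ : ∀ {x z} y → x ∙ z ≡ z → x ∙ (y ∙ z) ≡ y ∙ z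
    absorbs-∷ {x} {z} y x∙z≡z = trans (∙-swap x y z) (cong (y ∙_) x∙z≡z)

  foldr-absorbs : ∀ s xs → All (λ x → x ∙ foldr _∙_ s xs ≡ foldr _∙_ s xs) (s ∷ xs)
  foldr-absorbs s [] = idem s ∷ []
  foldr-absorbs s (y ∷ ys) with foldr-absorbs s ys
  ... | s-abs ∷ ys-abs =
    absorbs-∷ y s-abs ∷ ∙-idem-assoc y _ ∷ All.map (absorbs-∷ y) ys-abs

  foldr-∷-seed : ∀ s x xs → foldr _∙_ s (x ∷ xs) ≡ s ∙ foldr _∙_ x xs
  foldr-∷-seed s x [] = comm x s
  foldr-∷-seed s x (y ∷ ys) = begin
    x ∙ (y ∙ foldr _∙_ s ys)  ≡⟨ ∙-swap x y _ ⟩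
    y ∙ (x ∙ foldr _∙_ s ys)  ≡⟨ cong (y ∙_) (foldr-∷-seed s x ys) ⟩
    y ∙ (s ∙ foldr _∙_ x ys)  ≡⟨ ∙-swap y s _ ⟩
    s ∙ (y ∙ foldr _∙_ x ys)  ∎
    where open ≡-Reasoning

  foldr-Duplicated : ∀ {xs ys} → Duplicated xs ys → ∀ s → foldr _∙_ s xs ≡ foldr _∙_ s ys
  foldr-Duplicated (here x xs) s = sym (∙-idem-assoc x _)
  foldr-Duplicated (there x d) s = cong (x ∙_) (foldr-Duplicated d s)

  fold₁-Duplicated : ∀ {xs ys} → Duplicated xs ys → fold₁ _∙_ xs ≡ fold₁ _∙_ ys
  fold₁-Duplicated (here x xs) = cong just (sym (All.head (foldr-absorbs x xs)))
  fold₁-Duplicated (there x d) = cong just (foldr-Duplicated d x)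

count : {P : Pred ℕ 0ℓ} → Decidable P → List ℕ → ℕ
count P? ns = length (filter P? ns)

module _ {P : Pred ℕ 0ℓ} (P? : Decidable P) where

  count-∷ : ∀ x {ms ns} → DifferByOne (count P? ms) (count P? ns) →
            DifferByOne (count P? (x ∷ ms)) (count P? (x ∷ ns))
  count-∷ x d with P? x
  ... | yes _ = DifferByOne-suc d
  ... | no _ = d

_≤∞_ : ℕ → Maybe ℕ → Set
t ≤∞ nothing = ⊤
t ≤∞ just m = t ≤ m

_≤∞?_ : ∀ t u → Dec (t ≤∞ u)
t ≤∞? nothing = yes tt
t ≤∞? just m = t ≤? m

SN≡fold₁ : ∀ π → SN π ≡ fromMaybe 0 (fold₁ _⊓_ (nonOverlinedSizes π))
SN≡fold₁ π with nonOverlinedSizes π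
... | [] = refl
... | x ∷ xs = refl

LN~≡fold₁ : ∀ π → LN~ π ≡ fold₁ _⊔_ (nonOverlinedSizes π)
LN~≡fold₁ π with nonOverlinedSizes π
... | [] = refl
... | x ∷ xs = refl

ℓO≤N≡count : ∀ π → ℓO≤N π ≡ count (_≤∞? LN~ π) (overlinedSizes π)
ℓO≤N≡count π with LN~ π
... | nothing = sym (cong length (filter-all (_≤∞? nothing) (All.universal (λ _ → tt) (overlinedSizes π))))
... | just m = refl

SN≤nonOverlinedSizes : ∀ π → All (SN π ≤_) (nonOverlinedSizes π)
SN≤nonOverlinedSizes π rewrite SN≡fold₁ π with nonOverlinedSizes π
... | [] = []
... | x ∷ xs = All.map m⊓n≡n⇒n≤m (foldr-absorbs ⊓-isSemilattice x xs)

nonOverlinedSizes≤LN~ : ∀ π → All (_≤∞ LN~ π) (nonOverlinedSizes π)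
nonOverlinedSizes≤LN~ π rewrite LN~≡fold₁ π with nonOverlinedSizes π
... | [] = []
... | x ∷ xs = All.map m⊔n≡n⇒m≤n (foldr-absorbs ⊔-isSemilattice x xs)

foldr-⊓-≤-seed : ∀ x xs → foldr _⊓_ x xs ≤ x
foldr-⊓-≤-seed x xs = m⊓n≡n⇒n≤m (All.head (foldr-absorbs ⊓-isSemilattice x xs))

-- Overpartitions with a repeated part size

StrictlyDecreasing : List Part → Set
StrictlyDecreasing π = Linked _>_ (map size π)

strictlyDecreasing? : (π : List Part) → Dec (StrictlyDecreasing π)
strictlyDecreasing? π = linked? _>?_ (map size π)

repeated-part-not-overlined : ∀ {a b d} → Step (a , b) (a , d) → d ≡ false
repeated-part-not-overlined {d = false} _ = refl
repeated-part-not-overlined {d = true} (_ , a<a) = contradiction (a<a refl) (<-irrefl refl)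

toggle′ : Part → List Part → List Part
toggle′ p [] = p ∷ []
toggle′ (a , b) ((c , d) ∷ π) with a ≟ c
... | yes _ = (a , not b) ∷ (c , d) ∷ π
... | no _ = (a , b) ∷ toggle′ (c , d) π

toggle : List Part → List Part
toggle [] = []
toggle (p ∷ π) = toggle′ p π

toggle-∷ : ∀ c d π → ∃₂ λ d′ ρ → toggle ((c , d) ∷ π) ≡ (c , d′) ∷ ρ
toggle-∷ c d [] = d , [] , refl
toggle-∷ c d ((e , f) ∷ π) with c ≟ e
... | yes _ = not d , _ , refl
... | no _ = d , _ , refl

toggle-distinct : ∀ {a b c d} π → a ≢ c → toggle ((a , b) ∷ (c , d) ∷ π) ≡ (a , b) ∷ toggle ((c , d) ∷ π)
toggle-distinct {a} {c = c} π a≢c rewrite dec-no (a ≟ c) a≢c = refl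

toggle-involutive : ∀ p π → toggle (toggle (p ∷ π)) ≡ p ∷ π
toggle-involutive p [] = refl
toggle-involutive (a , b) ((c , d) ∷ π) with a ≟ c
... | yes refl rewrite ≟-diag {a} refl = cong (λ b′ → (a , b′) ∷ (a , d) ∷ π) (not-involutive b)
... | no a≢c with toggle-∷ c d π
...   | d′ , ρ , eq = begin
  toggle ((a , b) ∷ toggle ((c , d) ∷ π))  ≡⟨ cong (λ σ → toggle ((a , b) ∷ σ)) eq ⟩
  toggle ((a , b) ∷ (c , d′) ∷ ρ)          ≡⟨ toggle-distinct ρ a≢c ⟩
  (a , b) ∷ toggle ((c , d′) ∷ ρ)          ≡⟨ cong (λ σ → (a , b) ∷ toggle σ) (sym eq) ⟩
  (a , b) ∷ toggle (toggle ((c , d) ∷ π))  ≡⟨ cong ((a , b) ∷_) (toggle-involutive (c , d) π) ⟩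
  (a , b) ∷ (c , d) ∷ π                    ∎
  where open ≡-Reasoning

map-size-toggle : ∀ p π → map size (toggle (p ∷ π)) ≡ map size (p ∷ π)
map-size-toggle p [] = refl
map-size-toggle (a , b) ((c , d) ∷ π) with a ≟ c
... | yes _ = refl
... | no _ = cong (a ∷_) (map-size-toggle (c , d) π)

toggle-Step : ∀ p π → Linked Step (p ∷ π) → Linked Step (toggle (p ∷ π))
toggle-Step p [] _ = [-]
toggle-Step (a , b) ((c , d) ∷ π) (st ∷ lk) with a ≟ c
... | yes _ = st ∷ lk
... | no a≢c with toggle-∷ c d π | toggle-Step (c , d) π lk
...   | d′ , ρ , eq | lk′ rewrite eq = (<⇒≤ c<a , λ _ → c<a) ∷ lk′
  where
  c<a : c < a
  c<a = ≤∧≢⇒< (proj₁ st) (a≢c ∘ sym)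

toggle-HasNonOverlined : ∀ p π → Linked Step (p ∷ π) → HasNonOverlined (p ∷ π) → HasNonOverlined (toggle (p ∷ π))
toggle-HasNonOverlined p [] _ h = h
toggle-HasNonOverlined (a , b) ((c , d) ∷ π) (st ∷ lk) h with a ≟ c
... | yes refl = there (here (repeated-part-not-overlined {b = b} st))
toggle-HasNonOverlined (a , b) ((c , d) ∷ π) (st ∷ lk) (here eq) | no _ = here eq
toggle-HasNonOverlined (a , b) ((c , d) ∷ π) (st ∷ lk) (there h) | no _ = there (toggle-HasNonOverlined (c , d) π lk h)

¬StrictlyDecreasing-toggle : ∀ p π → ¬ StrictlyDecreasing (p ∷ π) → ¬ StrictlyDecreasing (toggle (p ∷ π))
¬StrictlyDecreasing-toggle p π ¬sd = ¬sd ∘ subst (Linked _>_) (map-size-toggle p π)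

¬Linked>-tail : ∀ {a c ns} → c ≤ a → a ≢ c → ¬ Linked _>_ (a ∷ c ∷ ns) → ¬ Linked _>_ (c ∷ ns)
¬Linked>-tail c≤a a≢c ¬sd sd = ¬sd (≤∧≢⇒< c≤a (a≢c ∘ sym) ∷ sd)

nonOverlinedSizes-toggle : ∀ p π → Linked Step (p ∷ π) → ¬ StrictlyDecreasing (p ∷ π) →
  Duplicated (nonOverlinedSizes (p ∷ π)) (nonOverlinedSizes (toggle (p ∷ π)))
  ⊎ Duplicated (nonOverlinedSizes (toggle (p ∷ π))) (nonOverlinedSizes (p ∷ π))
nonOverlinedSizes-toggle p [] _ ¬sd = contradiction [-] ¬sd
nonOverlinedSizes-toggle (a , b) ((c , d) ∷ π) (st ∷ lk) ¬sd with a ≟ c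
nonOverlinedSizes-toggle (a , true) ((a , d) ∷ π) (st ∷ lk) ¬sd | yes refl
  rewrite repeated-part-not-overlined {b = true} st = inj₁ (here a _)
nonOverlinedSizes-toggle (a , false) ((a , d) ∷ π) (st ∷ lk) ¬sd | yes refl
  rewrite repeated-part-not-overlined {b = false} st = inj₂ (here a _)
nonOverlinedSizes-toggle (a , true) ((c , d) ∷ π) (st ∷ lk) ¬sd | no a≢c =
  nonOverlinedSizes-toggle (c , d) π lk (¬Linked>-tail (proj₁ st) a≢c ¬sd)
nonOverlinedSizes-toggle (a , false) ((c , d) ∷ π) (st ∷ lk) ¬sd | no a≢c =
  Sum.map (there a) (there a) (nonOverlinedSizes-toggle (c , d) π lk (¬Linked>-tail (proj₁ st) a≢c ¬sd))

module _ {P : Pred ℕ 0ℓ} (P? : Decidable P) where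

  private
    count-overlined-at-repeat : ∀ a b π → All P (nonOverlinedSizes ((a , b) ∷ (a , false) ∷ π)) →
      DifferByOne (count P? (overlinedSizes ((a , not b) ∷ (a , false) ∷ π)))
                  (count P? (overlinedSizes ((a , b) ∷ (a , false) ∷ π)))
    count-overlined-at-repeat a true π (Pa ∷ _) = inj₁ (sym (cong length (filter-accept P? Pa)))
    count-overlined-at-repeat a false π (Pa ∷ _) = inj₂ (cong length (filter-accept P? Pa))

  count-overlined-toggle : ∀ p π → Linked Step (p ∷ π) → ¬ StrictlyDecreasing (p ∷ π) →
    All P (nonOverlinedSizes (p ∷ π)) →
    DifferByOne (count P? (overlinedSizes (toggle (p ∷ π)))) (count P? (overlinedSizes (p ∷ π)))
  count-overlined-toggle p [] _ ¬sd _ = contradiction [-] ¬sd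
  count-overlined-toggle (a , b) ((c , d) ∷ π) (st ∷ lk) ¬sd Pns with a ≟ c
  ... | yes refl with repeated-part-not-overlined {b = b} st
  ...   | refl = count-overlined-at-repeat a b π Pns
  count-overlined-toggle (a , true) ((c , d) ∷ π) (st ∷ lk) ¬sd Pns | no a≢c =
    count-∷ P? a (count-overlined-toggle (c , d) π lk (¬Linked>-tail (proj₁ st) a≢c ¬sd) Pns)
  count-overlined-toggle (a , false) ((c , d) ∷ π) (st ∷ lk) ¬sd (_ ∷ Pns) | no a≢c =
    count-overlined-toggle (c , d) π lk (¬Linked>-tail (proj₁ st) a≢c ¬sd) Pns

module _ (p : Part) (π : List Part) (steps : Linked Step (p ∷ π)) (¬sd : ¬ StrictlyDecreasing (p ∷ π)) where

  private
    fold₁-nonOverlinedSizes-toggle : ∀ {_∙_} → IsSemilattice _≡_ _∙_ →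
      fold₁ _∙_ (nonOverlinedSizes (toggle (p ∷ π))) ≡ fold₁ _∙_ (nonOverlinedSizes (p ∷ π))
    fold₁-nonOverlinedSizes-toggle L =
      [ sym ∘ fold₁-Duplicated L , fold₁-Duplicated L ]′ (nonOverlinedSizes-toggle p π steps ¬sd)

  SN-toggle : SN (toggle (p ∷ π)) ≡ SN (p ∷ π)
  SN-toggle = begin
    SN (toggle (p ∷ π))                                           ≡⟨ SN≡fold₁ (toggle (p ∷ π)) ⟩
    fromMaybe 0 (fold₁ _⊓_ (nonOverlinedSizes (toggle (p ∷ π))))  ≡⟨ cong (fromMaybe 0) (fold₁-nonOverlinedSizes-toggle ⊓-isSemilattice) ⟩
    fromMaybe 0 (fold₁ _⊓_ (nonOverlinedSizes (p ∷ π)))           ≡⟨ SN≡fold₁ (p ∷ π) ⟨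
    SN (p ∷ π)                                                    ∎
    where open ≡-Reasoning

  LN~-toggle : LN~ (toggle (p ∷ π)) ≡ LN~ (p ∷ π)
  LN~-toggle = begin
    LN~ (toggle (p ∷ π))                               ≡⟨ LN~≡fold₁ (toggle (p ∷ π)) ⟩
    fold₁ _⊔_ (nonOverlinedSizes (toggle (p ∷ π)))     ≡⟨ fold₁-nonOverlinedSizes-toggle ⊔-isSemilattice ⟩
    fold₁ _⊔_ (nonOverlinedSizes (p ∷ π))              ≡⟨ LN~≡fold₁ (p ∷ π) ⟨
    LN~ (p ∷ π)                                        ∎
    where open ≡-Reasoning

  ℓO≥N-toggle : DifferByOne (ℓO≥N (toggle (p ∷ π))) (ℓO≥N (p ∷ π))
  ℓO≥N-toggle rewrite SN-toggle =
    count-overlined-toggle (SN (p ∷ π) ≤?_) p π steps ¬sd (SN≤nonOverlinedSizes (p ∷ π))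

  ℓO≤N-toggle : DifferByOne (ℓO≤N (toggle (p ∷ π))) (ℓO≤N (p ∷ π))
  ℓO≤N-toggle rewrite ℓO≤N≡count (toggle (p ∷ π)) | ℓO≤N≡count (p ∷ π) | LN~-toggle =
    count-overlined-toggle (_≤∞? LN~ (p ∷ π)) p π steps ¬sd (nonOverlinedSizes≤LN~ (p ∷ π))

-- Overpartitions with distinct part sizes

flags : List Part → List Bool
flags = map overlined

countTrue : List Bool → ℕ
countTrue [] = 0
countTrue (true ∷ f) = suc (countTrue f)
countTrue (false ∷ f) = countTrue f

-- Both count every true when f has no false, matching LN~ = +∞ and SN = 0.
truesAfterFirstFalse : List Bool → ℕ
truesAfterFirstFalse [] = 0
truesAfterFirstFalse (true ∷ f) = if any not f then truesAfterFirstFalse f else suc (truesAfterFirstFalse f)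
truesAfterFirstFalse (false ∷ f) = countTrue f

truesBeforeLastFalse : List Bool → ℕ
truesBeforeLastFalse [] = 0
truesBeforeLastFalse (true ∷ f) = suc (truesBeforeLastFalse f)
truesBeforeLastFalse (false ∷ f) = if any not f then truesBeforeLastFalse f else 0

any-not-∷ʳ-true : ∀ f → any not (f ∷ʳ true) ≡ any not f
any-not-∷ʳ-true [] = refl
any-not-∷ʳ-true (true ∷ f) = any-not-∷ʳ-true f
any-not-∷ʳ-true (false ∷ f) = refl

any-not-∷ʳ-false : ∀ f → any not (f ∷ʳ false) ≡ true
any-not-∷ʳ-false [] = refl
any-not-∷ʳ-false (true ∷ f) = any-not-∷ʳ-false f
any-not-∷ʳ-false (false ∷ f) = refl

any-not-reverse : ∀ f → any not (reverse f) ≡ any not f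
any-not-reverse [] = refl
any-not-reverse (true ∷ f) rewrite unfold-reverse true f = trans (any-not-∷ʳ-true (reverse f)) (any-not-reverse f)
any-not-reverse (false ∷ f) rewrite unfold-reverse false f = any-not-∷ʳ-false (reverse f)

countTrue-∷ʳ-true : ∀ f → countTrue (f ∷ʳ true) ≡ suc (countTrue f)
countTrue-∷ʳ-true [] = refl
countTrue-∷ʳ-true (true ∷ f) = cong suc (countTrue-∷ʳ-true f)
countTrue-∷ʳ-true (false ∷ f) = countTrue-∷ʳ-true f

countTrue-∷ʳ-false : ∀ f → countTrue (f ∷ʳ false) ≡ countTrue f
countTrue-∷ʳ-false [] = refl
countTrue-∷ʳ-false (true ∷ f) = cong suc (countTrue-∷ʳ-false f)
countTrue-∷ʳ-false (false ∷ f) = countTrue-∷ʳ-false f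

truesAfterFirstFalse-∷ʳ-true : ∀ f → truesAfterFirstFalse (f ∷ʳ true) ≡ suc (truesAfterFirstFalse f)
truesAfterFirstFalse-∷ʳ-true [] = refl
truesAfterFirstFalse-∷ʳ-true (true ∷ f)
  rewrite any-not-∷ʳ-true f | truesAfterFirstFalse-∷ʳ-true f with any not f
... | true = refl
... | false = refl
truesAfterFirstFalse-∷ʳ-true (false ∷ f) = countTrue-∷ʳ-true f

truesAfterFirstFalse-∷ʳ-false : ∀ f →
  truesAfterFirstFalse (f ∷ʳ false) ≡ (if any not f then truesAfterFirstFalse f else 0)
truesAfterFirstFalse-∷ʳ-false [] = refl
truesAfterFirstFalse-∷ʳ-false (true ∷ f)
  rewrite any-not-∷ʳ-false f | truesAfterFirstFalse-∷ʳ-false f with any not f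
... | true = refl
... | false = refl
truesAfterFirstFalse-∷ʳ-false (false ∷ f) = countTrue-∷ʳ-false f

truesAfterFirstFalse-reverse : ∀ f → truesAfterFirstFalse (reverse f) ≡ truesBeforeLastFalse f
truesAfterFirstFalse-reverse [] = refl
truesAfterFirstFalse-reverse (true ∷ f) rewrite unfold-reverse true f =
  trans (truesAfterFirstFalse-∷ʳ-true (reverse f)) (cong suc (truesAfterFirstFalse-reverse f))
truesAfterFirstFalse-reverse (false ∷ f)
  rewrite unfold-reverse false f | truesAfterFirstFalse-∷ʳ-false (reverse f)
        | any-not-reverse f | truesAfterFirstFalse-reverse f = refl

length-overlinedSizes : ∀ π → length (overlinedSizes π) ≡ countTrue (flags π)
length-overlinedSizes [] = refl
length-overlinedSizes ((_ , true) ∷ π) = cong suc (length-overlinedSizes π)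
length-overlinedSizes ((_ , false) ∷ π) = length-overlinedSizes π

any-not-flags : ∀ π → any not (flags π) ≡ not (null (nonOverlinedSizes π))
any-not-flags [] = refl
any-not-flags ((_ , true) ∷ π) = any-not-flags π
any-not-flags ((_ , false) ∷ π) = refl

module _ {P : Pred ℕ 0ℓ} where

  All-nonOverlinedSizes : ∀ π → All P (map size π) → All P (nonOverlinedSizes π)
  All-nonOverlinedSizes [] [] = []
  All-nonOverlinedSizes ((_ , true) ∷ π) (_ ∷ Ps) = All-nonOverlinedSizes π Ps
  All-nonOverlinedSizes ((_ , false) ∷ π) (Pa ∷ Ps) = Pa ∷ All-nonOverlinedSizes π Ps

  All-overlinedSizes : ∀ π → All P (map size π) → All P (overlinedSizes π)
  All-overlinedSizes [] [] = []
  All-overlinedSizes ((_ , true) ∷ π) (Pa ∷ Ps) = Pa ∷ All-overlinedSizes π Ps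
  All-overlinedSizes ((_ , false) ∷ π) (_ ∷ Ps) = All-overlinedSizes π Ps

Linked>⇒All< : ∀ {a ns} → Linked _>_ (a ∷ ns) → All (_< a) ns
Linked>⇒All< [-] = []
Linked>⇒All< (a>n ∷ sd) = Linked⇒All (flip <-trans) a>n sd

LN~-overlined-∷ : ∀ a π → LN~ ((a , true) ∷ π) ≡ LN~ π
LN~-overlined-∷ a π = trans (LN~≡fold₁ ((a , true) ∷ π)) (sym (LN~≡fold₁ π))

SN-overlined-∷ : ∀ a π → SN ((a , true) ∷ π) ≡ SN π
SN-overlined-∷ a π = trans (SN≡fold₁ ((a , true) ∷ π)) (sym (SN≡fold₁ π))

LN~-nonOverlined-largest : ∀ a π → All (_< a) (map size π) → LN~ ((a , false) ∷ π) ≡ just a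
LN~-nonOverlined-largest a π below = trans (LN~≡fold₁ ((a , false) ∷ π)) (cong just (≤-antisym
  (foldr-preservesᵇ ⊔-lub ≤-refl (All.map <⇒≤ (All-nonOverlinedSizes π below)))
  (m⊔n≡n⇒m≤n (All.head (foldr-absorbs ⊔-isSemilattice a (nonOverlinedSizes π))))))

SN≤-above : ∀ a π → All (_< a) (map size π) → SN π ≤ a
SN≤-above a π below rewrite SN≡fold₁ π with nonOverlinedSizes π | All-nonOverlinedSizes π below
... | [] | _ = z≤n
... | x ∷ xs | x<a ∷ _ = ≤-trans (foldr-⊓-≤-seed x xs) (<⇒≤ x<a)

count-≤∞-LN~-above : ∀ a π → All (_< a) (map size π) →
  count (_≤∞? LN~ π) (a ∷ overlinedSizes π)
  ≡ (if any not (flags π) then count (_≤∞? LN~ π) (overlinedSizes π) else suc (count (_≤∞? LN~ π) (overlinedSizes π)))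
count-≤∞-LN~-above a π below rewrite LN~≡fold₁ π | any-not-flags π
  with nonOverlinedSizes π | All-nonOverlinedSizes π below
... | [] | _ = refl
... | x ∷ xs | x<a ∷ xs<a =
  cong length (filter-reject (_≤∞? just (foldr _⊔_ x xs)) (<⇒≱ (foldr-preservesᵇ ⊔-lub x<a xs<a)))

ℓO≥N-nonOverlined-largest : ∀ a π → All (_< a) (map size π) →
  ℓO≥N ((a , false) ∷ π) ≡ (if any not (flags π) then count (SN π ≤?_) (overlinedSizes π) else 0)
ℓO≥N-nonOverlined-largest a π below rewrite SN≡fold₁ ((a , false) ∷ π) | SN≡fold₁ π | any-not-flags π
  with nonOverlinedSizes π | All-nonOverlinedSizes π below
... | [] | _ = cong length (filter-none (a ≤?_) (All.map <⇒≱ (All-overlinedSizes π below)))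
... | x ∷ xs | x<a ∷ _ = cong (λ s → count (s ≤?_) (overlinedSizes π)) (begin
  foldr _⊓_ a (x ∷ xs)   ≡⟨ foldr-∷-seed ⊓-isSemilattice a x xs ⟩
  a ⊓ foldr _⊓_ x xs     ≡⟨ m≥n⇒m⊓n≡n (≤-trans (foldr-⊓-≤-seed x xs) (<⇒≤ x<a)) ⟩
  foldr _⊓_ x xs         ∎)
  where open ≡-Reasoning

ℓO≤N-strict : ∀ π → StrictlyDecreasing π → ℓO≤N π ≡ truesAfterFirstFalse (flags π)
ℓO≤N-strict [] _ = refl
ℓO≤N-strict ((a , false) ∷ π) sd = begin
  ℓO≤N ((a , false) ∷ π)                               ≡⟨ ℓO≤N≡count ((a , false) ∷ π) ⟩
  count (_≤∞? LN~ ((a , false) ∷ π)) (overlinedSizes π) ≡⟨ cong (λ u → count (_≤∞? u) (overlinedSizes π)) (LN~-nonOverlined-largest a π below) ⟩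
  count (_≤? a) (overlinedSizes π)                     ≡⟨ cong length (filter-all (_≤? a) (All.map <⇒≤ (All-overlinedSizes π below))) ⟩
  length (overlinedSizes π)                            ≡⟨ length-overlinedSizes π ⟩
  countTrue (flags π)                                  ∎
  where
  open ≡-Reasoning
  below : All (_< a) (map size π)
  below = Linked>⇒All< sd
ℓO≤N-strict ((a , true) ∷ π) sd = begin
  ℓO≤N ((a , true) ∷ π)                                ≡⟨ ℓO≤N≡count ((a , true) ∷ π) ⟩
  count (_≤∞? LN~ ((a , true) ∷ π)) (a ∷ overlinedSizes π) ≡⟨ cong (λ u → count (_≤∞? u) (a ∷ overlinedSizes π)) (LN~-overlined-∷ a π) ⟩
  count (_≤∞? LN~ π) (a ∷ overlinedSizes π)            ≡⟨ count-≤∞-LN~-above a π (Linked>⇒All< sd) ⟩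
  (if any not (flags π) then c else suc c)             ≡⟨ cong (λ k → if any not (flags π) then k else suc k) ih ⟩
  truesAfterFirstFalse (flags ((a , true) ∷ π))        ∎
  where
  open ≡-Reasoning
  c = count (_≤∞? LN~ π) (overlinedSizes π)
  ih : c ≡ truesAfterFirstFalse (flags π)
  ih = trans (sym (ℓO≤N≡count π)) (ℓO≤N-strict π (Linked.tail sd))

ℓO≥N-strict : ∀ π → StrictlyDecreasing π → ℓO≥N π ≡ truesBeforeLastFalse (flags π)
ℓO≥N-strict [] _ = refl
ℓO≥N-strict ((a , false) ∷ π) sd =
  trans (ℓO≥N-nonOverlined-largest a π (Linked>⇒All< sd))
        (cong (λ k → if any not (flags π) then k else 0) (ℓO≥N-strict π (Linked.tail sd)))
ℓO≥N-strict ((a , true) ∷ π) sd = begin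
  ℓO≥N ((a , true) ∷ π)                            ≡⟨ cong (λ s → count (s ≤?_) (a ∷ overlinedSizes π)) (SN-overlined-∷ a π) ⟩
  count (SN π ≤?_) (a ∷ overlinedSizes π)          ≡⟨ cong length (filter-accept (SN π ≤?_) (SN≤-above a π (Linked>⇒All< sd))) ⟩
  suc (ℓO≥N π)                                     ≡⟨ cong suc (ℓO≥N-strict π (Linked.tail sd)) ⟩
  suc (truesBeforeLastFalse (flags π))             ∎
  where open ≡-Reasoning

reverseOverlines : List Part → List Part
reverseOverlines π = zip (map size π) (reverse (flags π))

module _ {A B : Set} where

  map-proj₁-zip : ∀ (xs : List A) (ys : List B) → length xs ≡ length ys → map proj₁ (zip xs ys) ≡ xs
  map-proj₁-zip [] [] _ = refl
  map-proj₁-zip (x ∷ xs) (y ∷ ys) eq = cong (x ∷_) (map-proj₁-zip xs ys (suc-injective eq))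

  map-proj₂-zip : ∀ (xs : List A) (ys : List B) → length xs ≡ length ys → map proj₂ (zip xs ys) ≡ ys
  map-proj₂-zip [] [] _ = refl
  map-proj₂-zip (x ∷ xs) (y ∷ ys) eq = cong (y ∷_) (map-proj₂-zip xs ys (suc-injective eq))

  zip-map-proj : ∀ (xys : List (A × B)) → zip (map proj₁ xys) (map proj₂ xys) ≡ xys
  zip-map-proj [] = refl
  zip-map-proj (xy ∷ xys) = cong (xy ∷_) (zip-map-proj xys)

private
  length-sizes≡length-reverse-flags : ∀ π → length (map size π) ≡ length (reverse (flags π))
  length-sizes≡length-reverse-flags π =
    trans (length-map size π) (sym (trans (length-reverse (flags π)) (length-map overlined π)))

map-size-reverseOverlines : ∀ π → map size (reverseOverlines π) ≡ map size π
map-size-reverseOverlines π = map-proj₁-zip (map size π) (reverse (flags π)) (length-sizes≡length-reverse-flags π)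

flags-reverseOverlines : ∀ π → flags (reverseOverlines π) ≡ reverse (flags π)
flags-reverseOverlines π = map-proj₂-zip (map size π) (reverse (flags π)) (length-sizes≡length-reverse-flags π)

reverseOverlines-involutive : ∀ π → reverseOverlines (reverseOverlines π) ≡ π
reverseOverlines-involutive π = begin
  zip (map size (reverseOverlines π)) (reverse (flags (reverseOverlines π)))
    ≡⟨ cong₂ (λ ns f → zip ns (reverse f)) (map-size-reverseOverlines π) (flags-reverseOverlines π) ⟩
  zip (map size π) (reverse (reverse (flags π)))  ≡⟨ cong (zip (map size π)) (reverse-involutive (flags π)) ⟩
  zip (map size π) (flags π)                      ≡⟨ zip-map-proj π ⟩
  π                                               ∎
  where open ≡-Reasoning

reverseOverlines-HasNonOverlined : ∀ π → HasNonOverlined π → HasNonOverlined (reverseOverlines π)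
reverseOverlines-HasNonOverlined π h =
  Any.map⁻ (subst (Any (_≡ false)) (sym (flags-reverseOverlines π)) (Any.reverse⁺ (Any.map⁺ h)))

StrictlyDecreasing-reverseOverlines : ∀ π → StrictlyDecreasing π → StrictlyDecreasing (reverseOverlines π)
StrictlyDecreasing-reverseOverlines π = subst (Linked _>_) (sym (map-size-reverseOverlines π))

ℓO≤N-reverseOverlines : ∀ π → StrictlyDecreasing π → ℓO≤N (reverseOverlines π) ≡ ℓO≥N π
ℓO≤N-reverseOverlines π sd = begin
  ℓO≤N (reverseOverlines π)                          ≡⟨ ℓO≤N-strict (reverseOverlines π) (StrictlyDecreasing-reverseOverlines π sd) ⟩
  truesAfterFirstFalse (flags (reverseOverlines π))  ≡⟨ cong truesAfterFirstFalse (flags-reverseOverlines π) ⟩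
  truesAfterFirstFalse (reverse (flags π))           ≡⟨ truesAfterFirstFalse-reverse (flags π) ⟩
  truesBeforeLastFalse (flags π)                     ≡⟨ ℓO≥N-strict π sd ⟨
  ℓO≥N π                                             ∎
  where open ≡-Reasoning

ParitiesAgree : List Part → Set
ParitiesAgree π = ℓO≤N π % 2 ≡ ℓO≥N π % 2

module _ (p : Part) (π : List Part) (steps : Linked Step (p ∷ π)) (¬sd : ¬ StrictlyDecreasing (p ∷ π))
         (disagree : ¬ ParitiesAgree (p ∷ π)) where

  toggle-fixes-parity : ℓO≤N (toggle (p ∷ π)) % 2 ≡ ℓO≥N (p ∷ π) % 2
  toggle-fixes-parity = DifferByOne-flips-%2 (ℓO≥N (p ∷ π)) (ℓO≤N-toggle p π steps ¬sd) disagree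

  toggle-keeps-disagreement : ¬ ParitiesAgree (toggle (p ∷ π))
  toggle-keeps-disagreement agree = disagree (begin
    ℓO≤N (p ∷ π) % 2           ≡⟨ DifferByOne-flips-%2 (ℓO≤N (p ∷ π)) (ℓO≥N-toggle p π steps ¬sd) (disagree ∘ sym) ⟨
    ℓO≥N (toggle (p ∷ π)) % 2  ≡⟨ agree ⟨
    ℓO≤N (toggle (p ∷ π)) % 2  ≡⟨ toggle-fixes-parity ⟩
    ℓO≥N (p ∷ π) % 2           ∎)
    where open ≡-Reasoning

φ : List Part → List Part
φ π with strictlyDecreasing? π
... | yes _ = reverseOverlines π
... | no _ with ℓO≤N π % 2 ≟ ℓO≥N π % 2
...   | yes _ = π
...   | no _ = toggle π

φ-strict : ∀ π → StrictlyDecreasing π → φ π ≡ reverseOverlines π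
φ-strict π sd with strictlyDecreasing? π
... | yes _ = refl
... | no ¬sd = contradiction sd ¬sd

φ-agree : ∀ π → ¬ StrictlyDecreasing π → ParitiesAgree π → φ π ≡ π
φ-agree π ¬sd agree with strictlyDecreasing? π
... | yes sd = contradiction sd ¬sd
... | no _ with ℓO≤N π % 2 ≟ ℓO≥N π % 2
...   | yes _ = refl
...   | no disagree = contradiction agree disagree

φ-disagree : ∀ π → ¬ StrictlyDecreasing π → ¬ ParitiesAgree π → φ π ≡ toggle π
φ-disagree π ¬sd disagree with strictlyDecreasing? π
... | yes sd = contradiction sd ¬sd
... | no _ with ℓO≤N π % 2 ≟ ℓO≥N π % 2
...   | yes agree = contradiction agree disagree
...   | no _ = refl

StrictlyDecreasing⇒Step : ∀ π → StrictlyDecreasing π → Linked Step π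
StrictlyDecreasing⇒Step [] [] = []
StrictlyDecreasing⇒Step (p ∷ []) [-] = [-]
StrictlyDecreasing⇒Step (p ∷ q ∷ π) (q<p ∷ sd) = (<⇒≤ q<p , λ _ → q<p) ∷ StrictlyDecreasing⇒Step (q ∷ π) sd

IsOverpartition-sameSizes : ∀ {n π σ} → map size σ ≡ map size π → Linked Step σ →
                            IsOverpartition n π → IsOverpartition n σ
IsOverpartition-sameSizes eq steps (sum≡n , positive , _) =
  trans (cong sum eq) sum≡n , All.map⁻ (subst (All (1 ≤_)) (sym eq) (All.map⁺ positive)) , steps

φ-IsOverpartition : ∀ {n} π → IsOverpartition n π → IsOverpartition n (φ π)
φ-IsOverpartition π op with strictlyDecreasing? π
... | yes sd = IsOverpartition-sameSizes (map-size-reverseOverlines π)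
  (StrictlyDecreasing⇒Step (reverseOverlines π) (StrictlyDecreasing-reverseOverlines π sd)) op
... | no ¬sd with ℓO≤N π % 2 ≟ ℓO≥N π % 2
...   | yes _ = op
φ-IsOverpartition [] op | no ¬sd | no _ = contradiction [] ¬sd
φ-IsOverpartition (p ∷ π) op | no ¬sd | no _ =
  IsOverpartition-sameSizes (map-size-toggle p π) (toggle-Step p π (proj₂ (proj₂ op))) op

φ-involutive : ∀ π → Linked Step π → φ (φ π) ≡ π
φ-involutive π steps with strictlyDecreasing? π
... | yes sd = trans (φ-strict (reverseOverlines π) (StrictlyDecreasing-reverseOverlines π sd))
                     (reverseOverlines-involutive π)
... | no ¬sd with ℓO≤N π % 2 ≟ ℓO≥N π % 2
...   | yes agree = φ-agree π ¬sd agree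
φ-involutive [] steps | no ¬sd | no _ = contradiction [] ¬sd
φ-involutive (p ∷ π) steps | no ¬sd | no disagree =
  trans (φ-disagree (toggle (p ∷ π)) (¬StrictlyDecreasing-toggle p π ¬sd)
                    (toggle-keeps-disagreement p π steps ¬sd disagree))
        (toggle-involutive p π)

φ-HasNonOverlined : ∀ π → Linked Step π → HasNonOverlined π → HasNonOverlined (φ π)
φ-HasNonOverlined π steps h with strictlyDecreasing? π
... | yes _ = reverseOverlines-HasNonOverlined π h
... | no ¬sd with ℓO≤N π % 2 ≟ ℓO≥N π % 2
...   | yes _ = h
φ-HasNonOverlined (p ∷ π) steps h | no ¬sd | no _ = toggle-HasNonOverlined p π steps h

φ-parity : ∀ π → Linked Step π → ℓO≤N (φ π) % 2 ≡ ℓO≥N π % 2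
φ-parity π steps with strictlyDecreasing? π
... | yes sd = cong (_% 2) (ℓO≤N-reverseOverlines π sd)
... | no ¬sd with ℓO≤N π % 2 ≟ ℓO≥N π % 2
...   | yes agree = agree
φ-parity [] steps | no ¬sd | no _ = contradiction [] ¬sd
φ-parity (p ∷ π) steps | no ¬sd | no disagree = toggle-fixes-parity p π steps ¬sd disagree

lemma6p1 : (n : ℕ) → 1 ≤ n →
    Σ (List Part → List Part) (λ φ →
      ((π : List Part) → IsOverpartition n π → IsOverpartition n (φ π))
      × ((π : List Part) → IsOverpartition n π → φ (φ π) ≡ π)
      × ((π : List Part) → IsOverpartition n π → HasNonOverlined π → HasNonOverlined (φ π))
      × ((π : List Part) → IsOverpartition n π → ℓO≤N (φ π) % 2 ≡ ℓO≥N π % 2))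
lemma6p1 n _ =
  φ , φ-IsOverpartition
    , (λ π op → φ-involutive π (steps op))
    , (λ π op → φ-HasNonOverlined π (steps op))
    , (λ π op → φ-parity π (steps op))
  where
  steps : ∀ {π} → IsOverpartition n π → Linked Step π
  steps = proj₂ ∘ proj₂
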